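{- Let $\varepsilon > 0$ and let $G$ be a graph with $n$ vertices and maximum degree $d \ge 2$. If $h_{\varepsilon n}(G) > 1$, then for every integer $1 \le s \le \varepsilon n/(2d)$ and every vertex $v \in V(G)$ there exists a subset $X \subseteq V(G)$ with $|X| = s$, $v \in X$, $X$ inducing a connected subgraph of $G$, and \[ |N_G(X)| \ge |X|\left(h_{\varepsilon n}(G) - 1\right). \]
   Context: $N_G(X) = \left(\bigcup_{u\in X} N(u)\right)\setminus X$ is the external neighbourhood of $X$. For nonempty $S\subseteq V(G)$, $h(S) = e(S,V(G)\setminus S)/|S|$ where $e(A,B)$ counts edges between $A$ and $B$, and for $k>0$, $h_k(G) = \min\{h(S): \emptyset\ne S\subseteq V(G), |S|\le k\}$.
   Formalization: The parameter ε ranges over the positive rationals. -}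

module Defs where

open import Data.Nat using (ℕ; zero; suc; _≤_)
open import Data.Bool using (Bool; true; false; not; _∧_; _∨_; if_then_else_)
open import Data.Fin using (Fin; zero; suc)
open import Data.Fin.Subset using (Subset; _∈_; _∩_; ∁; ∣_∣; Nonempty)
open import Data.Vec using (tabulate; lookup; sum)
open import Data.Integer using (+_)
open import Data.Rational using (ℚ; 0ℚ; _/_; _*_)
open import Data.Product using (Σ; _×_; ∃)
open import Relation.Binary.PropositionalEquality using (_≡_)

record Graph (n : ℕ) : Set where
  field
    adj    : Fin n → Fin n → Bool
    sym    : ∀ u v → adj u v ≡ adj v u
    irrefl : ∀ v → adj v v ≡ false
open Graph public

anyFin : ∀ {n} → (Fin n → Bool) → Bool
anyFin {zero}  p = false
anyFin {suc n} p = p zero ∨ anyFin (λ i → p (suc i))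

nbhd : ∀ {n} → Graph n → Fin n → Subset n
nbhd G v = tabulate (adj G v)

degree : ∀ {n} → Graph n → Fin n → ℕ
degree G v = ∣ nbhd G v ∣

MaxDegree : ∀ {n} → Graph n → ℕ → Set
MaxDegree {n} G d = (∀ v → degree G v ≤ d) × (∃ λ (v : Fin n) → degree G v ≡ d)

extNbhd : ∀ {n} → Graph n → Subset n → Subset n
extNbhd G X = tabulate (λ w → not (lookup X w) ∧ anyFin (λ u → lookup X u ∧ adj G u w))

eCut : ∀ {n} → Graph n → Subset n → ℕ
eCut G S = sum (tabulate (λ u → if lookup S u then ∣ nbhd G u ∩ ∁ S ∣ else 0))

-- rational divided by a natural (only used with nonzero divisor)
_/ℕ_ : ℚ → ℕ → ℚ
q /ℕ zero  = 0ℚ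
q /ℕ suc m = q * ((+ 1) / suc m)

ℕtoℚ : ℕ → ℚ
ℕtoℚ m = (+ m) / 1

hS : ∀ {n} → Graph n → Subset n → ℚ
hS G S = ℕtoℚ (eCut G S) /ℕ ∣ S ∣

-- h_k(G) = min { h(S) : ∅ ≠ S ⊆ V(G), |S| ≤ k }, with the real bound k ∈ ℚ.
-- IsHk G k h  means: h is that minimum (attained and a lower bound).
IsHk : ∀ {n} → Graph n → ℚ → ℚ → Set
IsHk {n} G k h =
  (Σ (Subset n) λ S → Nonempty S × Data.Rational._≤_ (ℕtoℚ ∣ S ∣) k × hS G S ≡ h)
  × (∀ (S : Subset n) → Nonempty S → Data.Rational._≤_ (ℕtoℚ ∣ S ∣) k → Data.Rational._≤_ h (hS G S))
  where import Data.Rational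

data PathIn {n} (G : Graph n) (X : Subset n) : Fin n → Fin n → Set where
  here : ∀ {u} → u ∈ X → PathIn G X u u
  step : ∀ {u w v} → u ∈ X → adj G u w ≡ true → PathIn G X w v → PathIn G X u v

InducesConnected : ∀ {n} → Graph n → Subset n → Set
InducesConnected G X = Nonempty X × (∀ {u v} → u ∈ X → v ∈ X → PathIn G X u v)

-- Grow X greedily from {v}, keeping X connected with |N(X)| ≥ |X|(h − 1).  While |X| < s, the
-- set Y = X ∪ N(X) has at most |X|(d + 1) ≤ εn vertices, so at least h|Y| edges leave Y.  All of
-- them start in N(X), hence some u ∈ N(X) has at least h|Y|/|N(X)| ≥ h neighbours outside Y.
-- Adding u to X removes u from the external neighbourhood but adds all those neighbours, so
-- |N(X ∪ {u})| ≥ |N(X)| + h − 1 and the invariant survives.  It starts from |N({v})| = e({v}) ≥ h.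
module Submission where

open import Defs
open import Data.Bool using (Bool; true; false; not; _∧_; _∨_; if_then_else_)
open import Data.Bool.Properties using (∧-conicalˡ; ∧-conicalʳ)
open import Data.Nat as ℕ using (ℕ; zero; suc; _+_; _*_; _≤_; z≤n; s≤s)
import Data.Nat.Properties as ℕ
import Data.Nat.Coprimality as Coprimality
import Data.Integer as ℤ
import Data.Integer.Properties as ℤ
open import Data.Rational as ℚ using (ℚ; mkℚ; 0ℚ; 1ℚ)
import Data.Rational.Properties as ℚ
import Data.Rational.Unnormalised as ℚᵘ
import Data.Rational.Unnormalised.Properties as ℚᵘ
open import Data.Rational.Solver using (module +-*-Solver)
open import Data.Fin using (Fin; zero; suc; _≟_)
open import Data.Fin.Subset using (Subset; _∈_; _∉_; _⊆_; _∪_; _∩_; ∁; ⁅_⁆; Nonempty; Empty; ∣_∣)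
open import Data.Fin.Subset.Properties
  using (p⊆p∪q; q⊆p∪q; x∈p∩q⁻; x∈p∪q⁺; x∈p∪q⁻; x∈∁p⇒x∉p; ∣⊥∣≡0; Empty-unique; p⊆q⇒∣p∣≤∣q∣;
         ∣⁅x⁆∣≡1; x∈⁅x⁆; x∈⁅y⁆⇒x≡y)
open import Data.Vec as Vec using ([]; _∷_; lookup; tabulate)
open import Data.Vec.Properties using (lookup∘tabulate; []=⇒lookup; lookup⇒[]=)
open import Data.List using (allFin)
open import Data.List.Extrema ℕ.≤-totalOrder using (argmax; f[xs]≤f[argmax])
import Data.List.Relation.Unary.All as All
open import Data.List.Membership.Propositional.Properties using (∈-allFin)
open import Data.Product using (Σ; ∃; _×_; _,_; proj₁; proj₂)
open import Data.Sum using (inj₁; inj₂; [_,_]′)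
open import Function using (_∘_)
open import Relation.Nullary using (contradiction; yes; no)
open import Relation.Binary.PropositionalEquality as ≡ using (_≡_; refl; cong; cong₂; subst)
open import Algebra.Properties.Semiring.Sum ℕ.+-*-semiring
  using (sum; sum-syntax; sum-cong-≗; ∑-comm; *-distribˡ-sum; *-distribʳ-sum)

private
  variable
    n : ℕ
    S X : Subset n
    u w : Fin n

𝟙 : Bool → ℕ
𝟙 true  = 1
𝟙 false = 0

𝟙≤1 : ∀ b → 𝟙 b ≤ 1
𝟙≤1 true  = ℕ.≤-refl
𝟙≤1 false = z≤n

𝟙-∧ : ∀ a b → 𝟙 (a ∧ b) ≡ 𝟙 a * 𝟙 b
𝟙-∧ true  b = ≡.sym (ℕ.+-identityʳ (𝟙 b))
𝟙-∧ false b = refl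

𝟙-∧≤ʳ : ∀ a b → 𝟙 (a ∧ b) ≤ 𝟙 b
𝟙-∧≤ʳ true  b = ℕ.≤-refl
𝟙-∧≤ʳ false b = z≤n

𝟙-∨≤ : ∀ a b → 𝟙 (a ∨ b) ≤ 𝟙 a + 𝟙 b
𝟙-∨≤ true  b = s≤s z≤n
𝟙-∨≤ false b = ℕ.≤-refl

if-then-0≡𝟙* : ∀ b x → (if b then x else 0) ≡ 𝟙 b * x
if-then-0≡𝟙* true  x = ≡.sym (ℕ.+-identityʳ x)
if-then-0≡𝟙* false x = refl

∑-mono-≤ : {f g : Fin n → ℕ} → (∀ i → f i ≤ g i) → sum f ≤ sum g
∑-mono-≤ {zero}  f≤g = z≤n
∑-mono-≤ {suc n} f≤g = ℕ.+-mono-≤ (f≤g zero) (∑-mono-≤ (λ i → f≤g (suc i)))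

sum-tabulate : (f : Fin n → ℕ) → Vec.sum (tabulate f) ≡ sum f
sum-tabulate {zero}  f = refl
sum-tabulate {suc n} f = cong (f zero +_) (sum-tabulate (λ i → f (suc i)))

anyFin⁺ : (p : Fin n → Bool) (i : Fin n) → p i ≡ true → anyFin p ≡ true
anyFin⁺ p zero    pi rewrite pi = refl
anyFin⁺ p (suc i) pi with p zero
... | true  = refl
... | false = anyFin⁺ (λ j → p (suc j)) i pi

anyFin⁻ : (p : Fin n → Bool) → anyFin p ≡ true → ∃ λ i → p i ≡ true
anyFin⁻ {suc n} p any with p zero in p0
... | true  = zero , p0
... | false = let i , pi = anyFin⁻ (λ j → p (suc j)) any in suc i , pi

𝟙-anyFin≤∑ : (p : Fin n → Bool) → 𝟙 (anyFin p) ≤ ∑[ i < n ] 𝟙 (p i)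
𝟙-anyFin≤∑ {zero}  p = z≤n
𝟙-anyFin≤∑ {suc n} p =
  ℕ.≤-trans (𝟙-∨≤ (p zero) _) (ℕ.+-monoʳ-≤ (𝟙 (p zero)) (𝟙-anyFin≤∑ (λ i → p (suc i))))

lookup≡false⇒∉ : lookup S w ≡ false → w ∉ S
lookup≡false⇒∉ Sw≡false w∈S with ≡.trans (≡.sym Sw≡false) ([]=⇒lookup w∈S)
... | ()

∉⇒lookup≡false : w ∉ S → lookup S w ≡ false
∉⇒lookup≡false {w = w} {S} w∉S with lookup S w in Sw
... | true  = contradiction (lookup⇒[]= w S Sw) w∉S
... | false = refl

∈-tabulate⁺ : {p : Fin n → Bool} → p w ≡ true → w ∈ tabulate p
∈-tabulate⁺ {w = w} {p} pw = lookup⇒[]= w (tabulate p) (≡.trans (lookup∘tabulate p w) pw)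

∈-tabulate⁻ : {p : Fin n → Bool} → w ∈ tabulate p → p w ≡ true
∈-tabulate⁻ {w = w} {p} w∈ = ≡.trans (≡.sym (lookup∘tabulate p w)) ([]=⇒lookup w∈)

∣S∣≡∑𝟙 : (S : Subset n) → ∣ S ∣ ≡ ∑[ i < n ] 𝟙 (lookup S i)
∣S∣≡∑𝟙 []          = refl
∣S∣≡∑𝟙 (true ∷ S)  = cong suc (∣S∣≡∑𝟙 S)
∣S∣≡∑𝟙 (false ∷ S) = ∣S∣≡∑𝟙 S

∣tabulate∣≡∑𝟙 : (p : Fin n → Bool) → ∣ tabulate p ∣ ≡ ∑[ i < n ] 𝟙 (p i)
∣tabulate∣≡∑𝟙 p = ≡.trans (∣S∣≡∑𝟙 (tabulate p)) (sum-cong-≗ (λ i → cong 𝟙 (lookup∘tabulate p i)))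

∑𝟙*≤∣S∣* : (S : Subset n) (f : Fin n → ℕ) {c : ℕ} → (∀ i → i ∈ S → f i ≤ c) →
           ∑[ i < n ] (𝟙 (lookup S i) * f i) ≤ ∣ S ∣ * c
∑𝟙*≤∣S∣* {n} S f {c} f≤c = begin
  ∑[ i < n ] (𝟙 (lookup S i) * f i) ≤⟨ ∑-mono-≤ termwise ⟩
  ∑[ i < n ] (𝟙 (lookup S i) * c)   ≡⟨ *-distribʳ-sum c (λ i → 𝟙 (lookup S i)) ⟨
  (∑[ i < n ] 𝟙 (lookup S i)) * c   ≡⟨ cong (_* c) (∣S∣≡∑𝟙 S) ⟨
  ∣ S ∣ * c                         ∎
  where
  open ℕ.≤-Reasoning
  termwise : ∀ i → 𝟙 (lookup S i) * f i ≤ 𝟙 (lookup S i) * c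
  termwise i with lookup S i in Si
  ... | true  = ℕ.*-monoʳ-≤ 1 (f≤c i (lookup⇒[]= i S Si))
  ... | false = z≤n

∣p∪q∣+∣p∩q∣≡∣p∣+∣q∣ : (p q : Subset n) → ∣ p ∪ q ∣ + ∣ p ∩ q ∣ ≡ ∣ p ∣ + ∣ q ∣
∣p∪q∣+∣p∩q∣≡∣p∣+∣q∣ []          []          = refl
∣p∪q∣+∣p∩q∣≡∣p∣+∣q∣ (true ∷ p)  (true ∷ q)  = cong suc (begin
  ∣ p ∪ q ∣ + suc ∣ p ∩ q ∣    ≡⟨ ℕ.+-suc _ _ ⟩
  suc (∣ p ∪ q ∣ + ∣ p ∩ q ∣)  ≡⟨ cong suc (∣p∪q∣+∣p∩q∣≡∣p∣+∣q∣ p q) ⟩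
  suc (∣ p ∣ + ∣ q ∣)          ≡⟨ ℕ.+-suc _ _ ⟨
  ∣ p ∣ + suc ∣ q ∣            ∎)
  where open ≡.≡-Reasoning
∣p∪q∣+∣p∩q∣≡∣p∣+∣q∣ (true ∷ p)  (false ∷ q) = cong suc (∣p∪q∣+∣p∩q∣≡∣p∣+∣q∣ p q)
∣p∪q∣+∣p∩q∣≡∣p∣+∣q∣ (false ∷ p) (true ∷ q)  =
  ≡.trans (cong suc (∣p∪q∣+∣p∩q∣≡∣p∣+∣q∣ p q)) (≡.sym (ℕ.+-suc _ _))
∣p∪q∣+∣p∩q∣≡∣p∣+∣q∣ (false ∷ p) (false ∷ q) = ∣p∪q∣+∣p∩q∣≡∣p∣+∣q∣ p q

∣p∪q∣≤∣p∣+∣q∣ : (p q : Subset n) → ∣ p ∪ q ∣ ≤ ∣ p ∣ + ∣ q ∣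
∣p∪q∣≤∣p∣+∣q∣ p q = subst (∣ p ∪ q ∣ ≤_) (∣p∪q∣+∣p∩q∣≡∣p∣+∣q∣ p q) (ℕ.m≤m+n _ _)

Empty⇒∣p∣≡0 : {p : Subset n} → Empty p → ∣ p ∣ ≡ 0
Empty⇒∣p∣≡0 {n} p-empty = ≡.trans (cong ∣_∣ (Empty-unique p-empty)) (∣⊥∣≡0 n)

Empty-∩⇒∣p∪q∣≡∣p∣+∣q∣ : (p q : Subset n) → Empty (p ∩ q) → ∣ p ∪ q ∣ ≡ ∣ p ∣ + ∣ q ∣
Empty-∩⇒∣p∪q∣≡∣p∣+∣q∣ p q disjoint = begin
  ∣ p ∪ q ∣             ≡⟨ ℕ.+-identityʳ _ ⟨
  ∣ p ∪ q ∣ + 0         ≡⟨ cong (∣ p ∪ q ∣ +_) (Empty⇒∣p∣≡0 disjoint) ⟨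
  ∣ p ∪ q ∣ + ∣ p ∩ q ∣ ≡⟨ ∣p∪q∣+∣p∩q∣≡∣p∣+∣q∣ p q ⟩
  ∣ p ∣ + ∣ q ∣         ∎
  where open ≡.≡-Reasoning

∉⇒∣p∪⁅x⁆∣≡1+∣p∣ : {p : Subset n} {x : Fin n} → x ∉ p → ∣ p ∪ ⁅ x ⁆ ∣ ≡ suc ∣ p ∣
∉⇒∣p∪⁅x⁆∣≡1+∣p∣ {p = p} {x} x∉p = begin
  ∣ p ∪ ⁅ x ⁆ ∣      ≡⟨ Empty-∩⇒∣p∪q∣≡∣p∣+∣q∣ p ⁅ x ⁆ disjoint ⟩
  ∣ p ∣ + ∣ ⁅ x ⁆ ∣  ≡⟨ cong (∣ p ∣ +_) (∣⁅x⁆∣≡1 x) ⟩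
  ∣ p ∣ + 1          ≡⟨ ℕ.+-comm ∣ p ∣ 1 ⟩
  suc ∣ p ∣          ∎
  where
  open ≡.≡-Reasoning
  disjoint : Empty (p ∩ ⁅ x ⁆)
  disjoint (y , y∈p∩⁅x⁆) =
    let y∈p , y∈⁅x⁆ = x∈p∩q⁻ p ⁅ x ⁆ y∈p∩⁅x⁆ in x∉p (subst (_∈ p) (x∈⁅y⁆⇒x≡y x y∈⁅x⁆) y∈p)

p⊆q⇒∣p∩∁q∣≡0 : {p q : Subset n} → p ⊆ q → ∣ p ∩ ∁ q ∣ ≡ 0
p⊆q⇒∣p∩∁q∣≡0 {p = p} {q} p⊆q = Empty⇒∣p∣≡0 λ (x , x∈p∩∁q) →
  let x∈p , x∈∁q = x∈p∩q⁻ p (∁ q) x∈p∩∁q in x∈∁p⇒x∉p x∈∁q (p⊆q x∈p)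

x∈p⇒1≤∣p∣ : {p : Subset n} {x : Fin n} → x ∈ p → 1 ≤ ∣ p ∣
x∈p⇒1≤∣p∣ {p = p} {x} x∈p =
  subst (_≤ ∣ p ∣) (∣⁅x⁆∣≡1 x) (p⊆q⇒∣p∣≤∣q∣ (λ y∈⁅x⁆ → subst (_∈ p) (≡.sym (x∈⁅y⁆⇒x≡y x y∈⁅x⁆)) x∈p))

∉-∪ : {p q : Subset n} → w ∉ p → w ∉ q → w ∉ p ∪ q
∉-∪ {p = p} {q} w∉p w∉q w∈p∪q = [ w∉p , w∉q ]′ (x∈p∪q⁻ p q w∈p∪q)

module _ (G : Graph n) where

  ∈extNbhd⁺ : w ∉ X → u ∈ X → adj G u w ≡ true → w ∈ extNbhd G X
  ∈extNbhd⁺ {X = X} {u} w∉X u∈X uw = ∈-tabulate⁺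
    (cong₂ (λ b c → not b ∧ c) (∉⇒lookup≡false w∉X) (anyFin⁺ _ u (cong₂ _∧_ ([]=⇒lookup u∈X) uw)))

  ∈extNbhd⁻ : w ∈ extNbhd G X → w ∉ X × ∃ λ u → u ∈ X × adj G u w ≡ true
  ∈extNbhd⁻ {w = w} {X = X} w∈N with lookup X w in Xw | ∈-tabulate⁻ w∈N
  ... | false | hasNeighbourInX =
    let u , Xu∧uw = anyFin⁻ _ hasNeighbourInX
    in lookup≡false⇒∉ Xw , u , lookup⇒[]= u X (∧-conicalˡ _ _ Xu∧uw) , ∧-conicalʳ _ _ Xu∧uw

  nbhd∩∁⊆extNbhd : u ∈ S → nbhd G u ∩ ∁ S ⊆ extNbhd G S
  nbhd∩∁⊆extNbhd u∈S w∈ =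
    let w∈Nu , w∈∁S = x∈p∩q⁻ _ _ w∈ in ∈extNbhd⁺ (x∈∁p⇒x∉p w∈∁S) u∈S (∈-tabulate⁻ w∈Nu)

  nbhd⊆∪extNbhd : u ∈ X → nbhd G u ⊆ X ∪ extNbhd G X
  nbhd⊆∪extNbhd {X = X} u∈X {w} w∈Nu with lookup X w in Xw
  ... | true  = x∈p∪q⁺ (inj₁ (lookup⇒[]= w X Xw))
  ... | false = x∈p∪q⁺ (inj₂ (∈extNbhd⁺ (lookup≡false⇒∉ Xw) u∈X (∈-tabulate⁻ w∈Nu)))

  ∣extNbhd∣≤∣X∣*d : {d : ℕ} → (∀ u → degree G u ≤ d) → (X : Subset n) → ∣ extNbhd G X ∣ ≤ ∣ X ∣ * d
  ∣extNbhd∣≤∣X∣*d {d} degree≤d X = begin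
    ∣ extNbhd G X ∣                                       ≡⟨ ∣tabulate∣≡∑𝟙 inN ⟩
    ∑[ w < n ] 𝟙 (inN w)                                  ≤⟨ ∑-mono-≤ {n} 𝟙[inN]≤∑ ⟩
    ∑[ w < n ] ∑[ u < n ] 𝟙 (lookup X u ∧ adj G u w)      ≡⟨ ∑-comm (λ w u → 𝟙 (lookup X u ∧ adj G u w)) ⟩
    ∑[ u < n ] ∑[ w < n ] 𝟙 (lookup X u ∧ adj G u w)      ≡⟨ sum-cong-≗ ∑𝟙≡𝟙*degree ⟩
    ∑[ u < n ] (𝟙 (lookup X u) * degree G u)              ≤⟨ ∑𝟙*≤∣S∣* X (degree G) (λ u _ → degree≤d u) ⟩
    ∣ X ∣ * d                                             ∎
    where
    open ℕ.≤-Reasoning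
    inN : Fin n → Bool
    inN w = not (lookup X w) ∧ anyFin (λ u → lookup X u ∧ adj G u w)
    𝟙[inN]≤∑ : ∀ w → 𝟙 (inN w) ≤ ∑[ u < n ] 𝟙 (lookup X u ∧ adj G u w)
    𝟙[inN]≤∑ w = ℕ.≤-trans (𝟙-∧≤ʳ (not (lookup X w)) _) (𝟙-anyFin≤∑ (λ u → lookup X u ∧ adj G u w))
    ∑𝟙≡𝟙*degree : ∀ u → ∑[ w < n ] 𝟙 (lookup X u ∧ adj G u w) ≡ 𝟙 (lookup X u) * degree G u
    ∑𝟙≡𝟙*degree u = begin-equality
      ∑[ w < n ] 𝟙 (lookup X u ∧ adj G u w)        ≡⟨ sum-cong-≗ (λ w → 𝟙-∧ (lookup X u) (adj G u w)) ⟩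
      ∑[ w < n ] (𝟙 (lookup X u) * 𝟙 (adj G u w))  ≡⟨ *-distribˡ-sum (𝟙 (lookup X u)) (λ w → 𝟙 (adj G u w)) ⟨
      𝟙 (lookup X u) * ∑[ w < n ] 𝟙 (adj G u w)    ≡⟨ cong (𝟙 (lookup X u) *_) (∣tabulate∣≡∑𝟙 (adj G u)) ⟨
      𝟙 (lookup X u) * degree G u                  ∎

  eCut≡∑ : (S : Subset n) → eCut G S ≡ ∑[ u < n ] (𝟙 (lookup S u) * ∣ nbhd G u ∩ ∁ S ∣)
  eCut≡∑ S = ≡.trans (sum-tabulate (λ u → if lookup S u then ∣ nbhd G u ∩ ∁ S ∣ else 0))
                     (sum-cong-≗ (λ u → if-then-0≡𝟙* (lookup S u) _))

  eCut≤∣S∣*∣extNbhd∣ : (S : Subset n) → eCut G S ≤ ∣ S ∣ * ∣ extNbhd G S ∣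
  eCut≤∣S∣*∣extNbhd∣ S = subst (_≤ ∣ S ∣ * ∣ extNbhd G S ∣) (≡.sym (eCut≡∑ S))
    (∑𝟙*≤∣S∣* S _ (λ u u∈S → p⊆q⇒∣p∣≤∣q∣ (nbhd∩∁⊆extNbhd u∈S)))

  eCut[X∪extNbhd]≤∑ : (X : Subset n) → eCut G (X ∪ extNbhd G X) ≤
                      ∑[ u < n ] (𝟙 (lookup (extNbhd G X) u) * ∣ nbhd G u ∩ ∁ (X ∪ extNbhd G X) ∣)
  eCut[X∪extNbhd]≤∑ X = subst (_≤ ∑[ u < n ] (𝟙 (lookup N u) * leaving u)) (≡.sym (eCut≡∑ Y))
                              (∑-mono-≤ {n} termwise)
    where
    N Y : Subset n
    N = extNbhd G X
    Y = X ∪ N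
    leaving : Fin n → ℕ
    leaving u = ∣ nbhd G u ∩ ∁ Y ∣
    termwise : ∀ u → 𝟙 (lookup Y u) * leaving u ≤ 𝟙 (lookup N u) * leaving u
    termwise u with lookup N u in Nu | lookup X u in Xu
    ... | true  | _     = ℕ.*-monoˡ-≤ (leaving u) (𝟙≤1 (lookup Y u))
    ... | false | true  = ℕ.≤-reflexive (≡.trans (cong (𝟙 (lookup Y u) *_) nothingLeaves)
                                                (ℕ.*-zeroʳ (𝟙 (lookup Y u))))
      where
      nothingLeaves : leaving u ≡ 0
      nothingLeaves = p⊆q⇒∣p∩∁q∣≡0 (nbhd⊆∪extNbhd (lookup⇒[]= u X Xu))
    ... | false | false = ℕ.≤-reflexive (cong (λ b → 𝟙 b * leaving u)
      (∉⇒lookup≡false {S = Y} (∉-∪ (lookup≡false⇒∉ Xu) (lookup≡false⇒∉ Nu))))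

  -- N(X) and the neighbours of u outside X ∪ N(X) are disjoint and lie in N(X ∪ {u}) ∪ {u}.
  extNbhd-growth : u ∈ extNbhd G X →
                   ∣ extNbhd G X ∣ + ∣ nbhd G u ∩ ∁ (X ∪ extNbhd G X) ∣ ≤ ∣ extNbhd G (X ∪ ⁅ u ⁆) ∣ + 1
  extNbhd-growth {u = u} {X = X} u∈N = begin
    ∣ N ∣ + ∣ B ∣         ≡⟨ Empty-∩⇒∣p∪q∣≡∣p∣+∣q∣ N B disjoint ⟨
    ∣ N ∪ B ∣             ≤⟨ p⊆q⇒∣p∣≤∣q∣ N∪B⊆N′∪⁅u⁆ ⟩
    ∣ N′ ∪ ⁅ u ⁆ ∣        ≤⟨ ∣p∪q∣≤∣p∣+∣q∣ N′ ⁅ u ⁆ ⟩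
    ∣ N′ ∣ + ∣ ⁅ u ⁆ ∣    ≡⟨ cong (∣ N′ ∣ +_) (∣⁅x⁆∣≡1 u) ⟩
    ∣ N′ ∣ + 1            ∎
    where
    open ℕ.≤-Reasoning
    N B N′ : Subset n
    N  = extNbhd G X
    B  = nbhd G u ∩ ∁ (X ∪ N)
    N′ = extNbhd G (X ∪ ⁅ u ⁆)
    disjoint : Empty (N ∩ B)
    disjoint (w , w∈N∩B) =
      let w∈N , w∈B = x∈p∩q⁻ N B w∈N∩B in x∈∁p⇒x∉p (proj₂ (x∈p∩q⁻ _ _ w∈B)) (q⊆p∪q X N w∈N)
    N⊆N′∪⁅u⁆ : N ⊆ N′ ∪ ⁅ u ⁆
    N⊆N′∪⁅u⁆ {w} w∈N with w ≟ u
    ... | yes refl = q⊆p∪q N′ ⁅ u ⁆ (x∈⁅x⁆ u)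
    ... | no w≢u   = let w∉X , x , x∈X , xw = ∈extNbhd⁻ {X = X} w∈N in
      p⊆p∪q ⁅ u ⁆ (∈extNbhd⁺ {X = X ∪ ⁅ u ⁆} (∉-∪ w∉X (w≢u ∘ x∈⁅y⁆⇒x≡y u)) (p⊆p∪q ⁅ u ⁆ x∈X) xw)
    B⊆N′ : B ⊆ N′
    B⊆N′ {w} w∈B = ∈extNbhd⁺ (∉-∪ (w∉X∪N ∘ p⊆p∪q N) w∉⁅u⁆) (q⊆p∪q X ⁅ u ⁆ (x∈⁅x⁆ u)) (∈-tabulate⁻ w∈Nu)
      where
      w∈Nu = proj₁ (x∈p∩q⁻ _ _ w∈B)
      w∉X∪N = x∈∁p⇒x∉p (proj₂ (x∈p∩q⁻ _ _ w∈B))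
      w∉⁅u⁆ : w ∉ ⁅ u ⁆
      w∉⁅u⁆ w∈⁅u⁆ = w∉X∪N (subst (_∈ X ∪ N) (≡.sym (x∈⁅y⁆⇒x≡y u w∈⁅u⁆)) (q⊆p∪q X N u∈N))
    N∪B⊆N′∪⁅u⁆ : N ∪ B ⊆ N′ ∪ ⁅ u ⁆
    N∪B⊆N′∪⁅u⁆ w∈ = [ N⊆N′∪⁅u⁆ , p⊆p∪q ⁅ u ⁆ ∘ B⊆N′ ]′ (x∈p∪q⁻ N B w∈)

  PathIn-⊆ : X ⊆ S → PathIn G X u w → PathIn G S u w
  PathIn-⊆ X⊆S (here u∈X)         = here (X⊆S u∈X)
  PathIn-⊆ X⊆S (step u∈X uv path) = step (X⊆S u∈X) uv (PathIn-⊆ X⊆S path)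

  PathIn-snoc : {x : Fin n} → PathIn G X u w → adj G w x ≡ true → x ∈ X → PathIn G X u x
  PathIn-snoc (here u∈X)         wx x∈X = step u∈X wx (here x∈X)
  PathIn-snoc (step u∈X uv path) wx x∈X = step u∈X uv (PathIn-snoc path wx x∈X)

  InducesConnected-∪⁅⁆ : {x : Fin n} → InducesConnected G X → x ∈ X → adj G x u ≡ true →
                         InducesConnected G (X ∪ ⁅ u ⁆)
  InducesConnected-∪⁅⁆ {X = X} {u} {x} (_ , connected) x∈X xu = (x , X⊆X′ x∈X) , connected′
    where
    X⊆X′ : X ⊆ X ∪ ⁅ u ⁆
    X⊆X′ = p⊆p∪q ⁅ u ⁆
    u∈X′ : u ∈ X ∪ ⁅ u ⁆
    u∈X′ = q⊆p∪q X ⁅ u ⁆ (x∈⁅x⁆ u)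
    connected′ : ∀ {a b} → a ∈ X ∪ ⁅ u ⁆ → b ∈ X ∪ ⁅ u ⁆ → PathIn G (X ∪ ⁅ u ⁆) a b
    connected′ a∈ b∈ with x∈p∪q⁻ X ⁅ u ⁆ a∈ | x∈p∪q⁻ X ⁅ u ⁆ b∈
    ... | inj₁ a∈X   | inj₁ b∈X   = PathIn-⊆ X⊆X′ (connected a∈X b∈X)
    ... | inj₁ a∈X   | inj₂ b∈⁅u⁆ rewrite x∈⁅y⁆⇒x≡y u b∈⁅u⁆ =
      PathIn-snoc (PathIn-⊆ X⊆X′ (connected a∈X x∈X)) xu u∈X′
    ... | inj₂ a∈⁅u⁆ | inj₁ b∈X   rewrite x∈⁅y⁆⇒x≡y u a∈⁅u⁆ =
      step u∈X′ (≡.trans (sym G u x) xu) (PathIn-⊆ X⊆X′ (connected x∈X b∈X))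
    ... | inj₂ a∈⁅u⁆ | inj₂ b∈⁅u⁆ rewrite x∈⁅y⁆⇒x≡y u a∈⁅u⁆ | x∈⁅y⁆⇒x≡y u b∈⁅u⁆ = here u∈X′

ℕtoℚ≡mkℚ : ∀ m → ℕtoℚ m ≡ mkℚ (ℤ.+ m) 0 (Coprimality.sym (Coprimality.1-coprimeTo m))
ℕtoℚ≡mkℚ m = ℚ.normalize-coprime (Coprimality.sym (Coprimality.1-coprimeTo m))

ℕtoℚ-+ : ∀ a b → ℕtoℚ (a + b) ≡ ℕtoℚ a ℚ.+ ℕtoℚ b
ℕtoℚ-+ a b = ℚ.toℚᵘ-injective (ℚᵘ.≃-trans homo (ℚᵘ.≃-sym (ℚ.toℚᵘ-homo-+ (ℕtoℚ a) (ℕtoℚ b))))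
  where
  homo : ℚ.toℚᵘ (ℕtoℚ (a + b)) ℚᵘ.≃ ℚ.toℚᵘ (ℕtoℚ a) ℚᵘ.+ ℚ.toℚᵘ (ℕtoℚ b)
  homo rewrite ℕtoℚ≡mkℚ (a + b) | ℕtoℚ≡mkℚ a | ℕtoℚ≡mkℚ b = ℚᵘ.*≡* (begin
    ℤ.+ (a + b) ℤ.* ℤ.+ 1                             ≡⟨ ℤ.*-identityʳ _ ⟩
    ℤ.+ (a + b)                                       ≡⟨ ℤ.pos-+ a b ⟩
    ℤ.+ a ℤ.+ ℤ.+ b
      ≡⟨ cong₂ ℤ._+_ (ℤ.*-identityʳ (ℤ.+ a)) (ℤ.*-identityʳ (ℤ.+ b)) ⟨
    ℤ.+ a ℤ.* ℤ.+ 1 ℤ.+ ℤ.+ b ℤ.* ℤ.+ 1               ≡⟨ ℤ.*-identityʳ _ ⟨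
    (ℤ.+ a ℤ.* ℤ.+ 1 ℤ.+ ℤ.+ b ℤ.* ℤ.+ 1) ℤ.* ℤ.+ 1   ∎)
    where open ≡.≡-Reasoning

ℕtoℚ-* : ∀ a b → ℕtoℚ (a * b) ≡ ℕtoℚ a ℚ.* ℕtoℚ b
ℕtoℚ-* a b = ℚ.toℚᵘ-injective (ℚᵘ.≃-trans homo (ℚᵘ.≃-sym (ℚ.toℚᵘ-homo-* (ℕtoℚ a) (ℕtoℚ b))))
  where
  homo : ℚ.toℚᵘ (ℕtoℚ (a * b)) ℚᵘ.≃ ℚ.toℚᵘ (ℕtoℚ a) ℚᵘ.* ℚ.toℚᵘ (ℕtoℚ b)
  homo rewrite ℕtoℚ≡mkℚ (a * b) | ℕtoℚ≡mkℚ a | ℕtoℚ≡mkℚ b =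
    ℚᵘ.*≡* (≡.trans (ℤ.*-identityʳ _) (≡.trans (ℤ.pos-* a b) (≡.sym (ℤ.*-identityʳ _))))

ℕtoℚ-mono-≤ : ∀ {a b} → a ≤ b → ℕtoℚ a ℚ.≤ ℕtoℚ b
ℕtoℚ-mono-≤ {a} {b} a≤b rewrite ℕtoℚ≡mkℚ a | ℕtoℚ≡mkℚ b =
  ℚ.*≤* (ℤ.*-monoʳ-≤-nonNeg (ℤ.+ 1) (ℤ.+≤+ a≤b))

ℕtoℚ-pos : ∀ m → ℚ.Positive (ℕtoℚ (suc m))
ℕtoℚ-pos m rewrite ℕtoℚ≡mkℚ (suc m) = _

≤/ℕ⇒*≤ : ∀ {p q k} → 1 ≤ k → p ℚ.≤ q /ℕ k → p ℚ.* ℕtoℚ k ℚ.≤ q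
≤/ℕ⇒*≤ {p} {q} {suc k} _ p≤q/k = begin
  p ℚ.* ℕtoℚ (suc k)                           ≤⟨ ℚ.*-monoʳ-≤-nonNeg (ℕtoℚ (suc k)) {{k≥0}} p≤q/k ⟩
  q ℚ.* (ℤ.+ 1 ℚ./ suc k) ℚ.* ℕtoℚ (suc k)     ≡⟨ ℚ.*-assoc q _ _ ⟩
  q ℚ.* ((ℤ.+ 1 ℚ./ suc k) ℚ.* ℕtoℚ (suc k))   ≡⟨ cong (q ℚ.*_) 1/k*k≡1 ⟩
  q ℚ.* 1ℚ                                     ≡⟨ ℚ.*-identityʳ q ⟩
  q                                            ∎
  where
  open ℚ.≤-Reasoning
  k≥0 : ℚ.NonNegative (ℕtoℚ (suc k))
  k≥0 = ℚ.pos⇒nonNeg (ℕtoℚ (suc k)) {{ℕtoℚ-pos k}}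
  1/k*k≡1 : (ℤ.+ 1 ℚ./ suc k) ℚ.* ℕtoℚ (suc k) ≡ 1ℚ
  1/k*k≡1 rewrite ℕtoℚ≡mkℚ (suc k) | ℚ.normalize-coprime {1} {k} (Coprimality.1-coprimeTo (suc k)) =
    ℚ.*-inverseˡ (mkℚ (ℤ.+ suc k) 0 (Coprimality.sym (Coprimality.1-coprimeTo (suc k))))

*ℕtoℚ≤ℕtoℚ*⇒≤ : ∀ {p c k} → 1 ≤ k → p ℚ.* ℕtoℚ k ℚ.≤ ℕtoℚ (k * c) → p ℚ.≤ ℕtoℚ c
*ℕtoℚ≤ℕtoℚ*⇒≤ {p} {c} {suc k} _ pk≤kc = ℚ.*-cancelʳ-≤-pos (ℕtoℚ (suc k)) {{ℕtoℚ-pos k}}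
  (ℚ.≤-trans pk≤kc (ℚ.≤-reflexive (≡.trans (ℕtoℚ-* (suc k) c) (ℚ.*-comm (ℕtoℚ (suc k)) (ℕtoℚ c)))))

0<p≤ℕtoℚ[𝟙*]⇒ : ∀ {p} b x → 0ℚ ℚ.< p → p ℚ.≤ ℕtoℚ (𝟙 b * x) → b ≡ true × p ℚ.≤ ℕtoℚ x
0<p≤ℕtoℚ[𝟙*]⇒ {p} true  x _   p≤x = refl , subst (λ y → p ℚ.≤ ℕtoℚ y) (ℕ.+-identityʳ x) p≤x
0<p≤ℕtoℚ[𝟙*]⇒     false x 0<p p≤0 = contradiction (ℚ.<-≤-trans 0<p p≤0) (ℚ.<-irrefl refl)

open +-*-Solver using (solve; _:=_; _:+_; _:*_; _:-_; con)

h≤x⇒1*[h-1]≤x : ∀ h {x} → h ℚ.≤ x → ℕtoℚ 1 ℚ.* (h ℚ.- 1ℚ) ℚ.≤ x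
h≤x⇒1*[h-1]≤x h {x} h≤x = begin
  1ℚ ℚ.* (h ℚ.- 1ℚ)  ≡⟨ solve 1 (λ h → con 1ℚ :* (h :- con 1ℚ) := h :- con 1ℚ) refl h ⟩
  h ℚ.- 1ℚ           ≤⟨ ℚ.+-monoʳ-≤ h (ℚ.nonPositive⁻¹ (ℚ.- 1ℚ)) ⟩
  h ℚ.+ 0ℚ           ≡⟨ ℚ.+-identityʳ h ⟩
  h                  ≤⟨ h≤x ⟩
  x                  ∎
  where open ℚ.≤-Reasoning

invariant-step : ∀ h k a a′ c → ℕtoℚ k ℚ.* (h ℚ.- 1ℚ) ℚ.≤ ℕtoℚ a → h ℚ.≤ ℕtoℚ c → a + c ≤ a′ + 1 →
                 ℕtoℚ (suc k) ℚ.* (h ℚ.- 1ℚ) ℚ.≤ ℕtoℚ a′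
invariant-step h k a a′ c k[h-1]≤a h≤c a+c≤a′+1 = begin
  ℕtoℚ (suc k) ℚ.* (h ℚ.- 1ℚ)           ≡⟨ cong (ℚ._* (h ℚ.- 1ℚ)) (ℕtoℚ-+ 1 k) ⟩
  (1ℚ ℚ.+ ℕtoℚ k) ℚ.* (h ℚ.- 1ℚ)        ≡⟨ solve 2 (λ k h → (con 1ℚ :+ k) :* (h :- con 1ℚ)
                                                         := k :* (h :- con 1ℚ) :+ (h :- con 1ℚ))
                                                 refl (ℕtoℚ k) h ⟩
  ℕtoℚ k ℚ.* (h ℚ.- 1ℚ) ℚ.+ (h ℚ.- 1ℚ)  ≤⟨ ℚ.+-mono-≤ k[h-1]≤a (ℚ.+-monoˡ-≤ (ℚ.- 1ℚ) h≤c) ⟩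
  ℕtoℚ a ℚ.+ (ℕtoℚ c ℚ.- 1ℚ)            ≡⟨ solve 2 (λ a c → a :+ (c :- con 1ℚ) := (a :+ c) :- con 1ℚ)
                                                 refl (ℕtoℚ a) (ℕtoℚ c) ⟩
  (ℕtoℚ a ℚ.+ ℕtoℚ c) ℚ.- 1ℚ            ≡⟨ cong (ℚ._- 1ℚ) (ℕtoℚ-+ a c) ⟨
  ℕtoℚ (a + c) ℚ.- 1ℚ                   ≤⟨ ℚ.+-monoˡ-≤ (ℚ.- 1ℚ) (ℕtoℚ-mono-≤ a+c≤a′+1) ⟩
  ℕtoℚ (a′ + 1) ℚ.- 1ℚ                  ≡⟨ cong (ℚ._- 1ℚ) (ℕtoℚ-+ a′ 1) ⟩
  (ℕtoℚ a′ ℚ.+ 1ℚ) ℚ.- 1ℚ               ≡⟨ solve 1 (λ a → (a :+ con 1ℚ) :- con 1ℚ := a) refl (ℕtoℚ a′) ⟩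
  ℕtoℚ a′                               ∎
  where open ℚ.≤-Reasoning

-- The paper's h_m(G) ≥ h, with the bound on |S| an integer m.
SmallSetExpansion : Graph n → ℕ → ℚ → Set
SmallSetExpansion {n} G m h =
  ∀ (S : Subset n) → Nonempty S → ∣ S ∣ ≤ m → h ℚ.* ℕtoℚ ∣ S ∣ ℚ.≤ ℕtoℚ (eCut G S)

ConnectedExpandingSet : Graph n → ℚ → ℕ → Fin n → Subset n → Set
ConnectedExpandingSet G h s v X =
  ∣ X ∣ ≡ s × v ∈ X × InducesConnected G X × ℕtoℚ ∣ extNbhd G X ∣ ℚ.≥ ℕtoℚ ∣ X ∣ ℚ.* (h ℚ.- 1ℚ)

module Greedy (G : Graph n) {d : ℕ} (degree≤d : ∀ u → degree G u ≤ d)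
              {h : ℚ} (1<h : 1ℚ ℚ.< h) {m : ℕ} (expansion : SmallSetExpansion G m h) where

  heavyNeighbour : {v : Fin n} → v ∈ X → ∣ X ∣ * suc d ≤ m →
                   ∃ λ u → u ∈ extNbhd G X × h ℚ.≤ ℕtoℚ ∣ nbhd G u ∩ ∁ (X ∪ extNbhd G X) ∣
  heavyNeighbour {X = X} {v} v∈X ∣X∣[1+d]≤m = u* , lookup⇒[]= u* N (proj₁ u*-heavy) , proj₂ u*-heavy
    where
    N Y : Subset n
    N = extNbhd G X
    Y = X ∪ N
    leaving : Fin n → ℕ
    leaving w = ∣ nbhd G w ∩ ∁ Y ∣
    -- g vanishes off N(X); since its maximum is at least h > 0, the maximiser lies in N(X).
    g : Fin n → ℕ
    g w = 𝟙 (lookup N w) * leaving w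
    u* : Fin n
    u* = argmax g v (allFin n)
    g≤g[u*] : ∀ w → g w ≤ g u*
    g≤g[u*] w = All.lookup (f[xs]≤f[argmax] v (allFin n)) (∈-allFin w)
    v∈Y : v ∈ Y
    v∈Y = p⊆p∪q N v∈X
    ∣Y∣≤m : ∣ Y ∣ ≤ m
    ∣Y∣≤m = begin
      ∣ Y ∣              ≤⟨ ∣p∪q∣≤∣p∣+∣q∣ X N ⟩
      ∣ X ∣ + ∣ N ∣      ≤⟨ ℕ.+-monoʳ-≤ ∣ X ∣ (∣extNbhd∣≤∣X∣*d G degree≤d X) ⟩
      ∣ X ∣ + ∣ X ∣ * d  ≡⟨ ℕ.*-suc ∣ X ∣ d ⟨
      ∣ X ∣ * suc d      ≤⟨ ∣X∣[1+d]≤m ⟩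
      m                  ∎
      where open ℕ.≤-Reasoning
    eCut≤∣Y∣*g[u*] : eCut G Y ≤ ∣ Y ∣ * g u*
    eCut≤∣Y∣*g[u*] = begin
      eCut G Y                                 ≤⟨ eCut[X∪extNbhd]≤∑ G X ⟩
      ∑[ w < n ] (𝟙 (lookup N w) * leaving w)  ≤⟨ ∑𝟙*≤∣S∣* N leaving leaving≤g[u*] ⟩
      ∣ N ∣ * g u*                             ≤⟨ ℕ.*-monoˡ-≤ (g u*) (p⊆q⇒∣p∣≤∣q∣ (q⊆p∪q X N)) ⟩
      ∣ Y ∣ * g u*                             ∎
      where
      open ℕ.≤-Reasoning
      leaving≤g[u*] : ∀ w → w ∈ N → leaving w ≤ g u*
      leaving≤g[u*] w w∈N = subst (_≤ g u*)
        (≡.trans (cong (λ b → 𝟙 b * leaving w) ([]=⇒lookup w∈N)) (ℕ.+-identityʳ (leaving w))) (g≤g[u*] w)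
    h≤g[u*] : h ℚ.≤ ℕtoℚ (g u*)
    h≤g[u*] = *ℕtoℚ≤ℕtoℚ*⇒≤ (x∈p⇒1≤∣p∣ v∈Y)
      (ℚ.≤-trans (expansion Y (v , v∈Y) ∣Y∣≤m) (ℕtoℚ-mono-≤ eCut≤∣Y∣*g[u*]))
    u*-heavy : lookup N u* ≡ true × h ℚ.≤ ℕtoℚ (leaving u*)
    u*-heavy = 0<p≤ℕtoℚ[𝟙*]⇒ (lookup N u*) (leaving u*) (ℚ.<-trans (ℚ.positive⁻¹ 1ℚ) 1<h) h≤g[u*]

  singleton : (v : Fin n) → 1 ≤ m → ConnectedExpandingSet G h 1 v ⁅ v ⁆
  singleton v 1≤m = ∣⁅x⁆∣≡1 v , x∈⁅x⁆ v , ((v , x∈⁅x⁆ v) , connected) , expanding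
    where
    connected : ∀ {a b} → a ∈ ⁅ v ⁆ → b ∈ ⁅ v ⁆ → PathIn G ⁅ v ⁆ a b
    connected a∈⁅v⁆ b∈⁅v⁆ rewrite x∈⁅y⁆⇒x≡y v a∈⁅v⁆ | x∈⁅y⁆⇒x≡y v b∈⁅v⁆ = here (x∈⁅x⁆ v)
    h≤∣N∣ : h ℚ.≤ ℕtoℚ ∣ extNbhd G ⁅ v ⁆ ∣
    h≤∣N∣ = *ℕtoℚ≤ℕtoℚ*⇒≤ (x∈p⇒1≤∣p∣ (x∈⁅x⁆ v))
      (ℚ.≤-trans (expansion ⁅ v ⁆ (v , x∈⁅x⁆ v) (subst (_≤ m) (≡.sym (∣⁅x⁆∣≡1 v)) 1≤m))
                 (ℕtoℚ-mono-≤ (eCut≤∣S∣*∣extNbhd∣ G ⁅ v ⁆)))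
    expanding : ℕtoℚ ∣ ⁅ v ⁆ ∣ ℚ.* (h ℚ.- 1ℚ) ℚ.≤ ℕtoℚ ∣ extNbhd G ⁅ v ⁆ ∣
    expanding = subst (λ j → ℕtoℚ j ℚ.* (h ℚ.- 1ℚ) ℚ.≤ ℕtoℚ ∣ extNbhd G ⁅ v ⁆ ∣) (≡.sym (∣⁅x⁆∣≡1 v))
                      (h≤x⇒1*[h-1]≤x h h≤∣N∣)

  extend : ∀ {k v} → k * suc d ≤ m → ConnectedExpandingSet G h k v X →
           Σ (Subset n) (ConnectedExpandingSet G h (suc k) v)
  extend {X = X} k[1+d]≤m (∣X∣≡k , v∈X , connected , expanding) =
    let u , u∈N , h≤leaving = heavyNeighbour v∈X (subst (λ j → j * suc d ≤ m) (≡.sym ∣X∣≡k) k[1+d]≤m)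
        u∉X , x , x∈X , xu   = ∈extNbhd⁻ G u∈N
        ∣X′∣≡1+∣X∣            = ∉⇒∣p∪⁅x⁆∣≡1+∣p∣ u∉X
    in X ∪ ⁅ u ⁆
     , ≡.trans ∣X′∣≡1+∣X∣ (cong suc ∣X∣≡k)
     , p⊆p∪q ⁅ u ⁆ v∈X
     , InducesConnected-∪⁅⁆ G connected x∈X xu
     , subst (λ j → ℕtoℚ j ℚ.* (h ℚ.- 1ℚ) ℚ.≤ ℕtoℚ ∣ extNbhd G (X ∪ ⁅ u ⁆) ∣) (≡.sym ∣X′∣≡1+∣X∣)
         (invariant-step h (∣ X ∣) (∣ extNbhd G X ∣) (∣ extNbhd G (X ∪ ⁅ u ⁆) ∣)
                         (∣ nbhd G u ∩ ∁ (X ∪ extNbhd G X) ∣) expanding h≤leaving (extNbhd-growth G u∈N))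

  connectedExpandingSet : ∀ k → suc k * suc d ≤ m → (v : Fin n) →
                          Σ (Subset n) (ConnectedExpandingSet G h (suc k) v)
  connectedExpandingSet zero    [1+d]≤m      v = ⁅ v ⁆ , singleton v (ℕ.≤-trans (s≤s z≤n) [1+d]≤m)
  connectedExpandingSet (suc k) [2+k][1+d]≤m v =
    let [1+k][1+d]≤m = ℕ.≤-trans (ℕ.*-monoˡ-≤ (suc d) (ℕ.n≤1+n (suc k))) [2+k][1+d]≤m
    in extend [1+k][1+d]≤m (proj₂ (connectedExpandingSet k [1+k][1+d]≤m v))

lemma2p3 : (ε : ℚ) → ε ℚ.> 0ℚ → (n : ℕ) → (G : Graph n) → (d : ℕ) → 2 ≤ d → MaxDegree G d →
    (h : ℚ) → IsHk G (ε ℚ.* ℕtoℚ n) h → h ℚ.> 1ℚ →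
    (s : ℕ) → 1 ≤ s → ℕtoℚ s ℚ.≤ (ε ℚ.* ℕtoℚ n) /ℕ (2 * d) →
    (v : Fin n) →
    Σ (Subset n) λ X → ∣ X ∣ ≡ s × v ∈ X × InducesConnected G X ×
      ℕtoℚ ∣ extNbhd G X ∣ ℚ.≥ ℕtoℚ ∣ X ∣ ℚ.* (h ℚ.- 1ℚ)
lemma2p3 ε _ n G d 2≤d (degree≤d , _) h (_ , minimal) 1<h (suc j) (s≤s z≤n) s≤εn/2d v =
  Greedy.connectedExpandingSet G degree≤d 1<h expansion j (ℕ.*-monoʳ-≤ (suc j) 1+d≤2d) v
  where
  1≤d : 1 ≤ d
  1≤d = ℕ.≤-trans (s≤s z≤n) 2≤d
  1+d≤2d : suc d ≤ 2 * d
  1+d≤2d = subst (suc d ≤_) (cong (d +_) (≡.sym (ℕ.+-identityʳ d))) (ℕ.+-monoˡ-≤ d 1≤d)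
  s*2d≤εn : ℕtoℚ (suc j * (2 * d)) ℚ.≤ ε ℚ.* ℕtoℚ n
  s*2d≤εn = ℚ.≤-trans (ℚ.≤-reflexive (ℕtoℚ-* (suc j) (2 * d)))
    (≤/ℕ⇒*≤ (ℕ.≤-trans 1≤d (ℕ.m≤m+n d (d + 0))) s≤εn/2d)
  expansion : SmallSetExpansion G (suc j * (2 * d)) h
  expansion S (x , x∈S) ∣S∣≤s*2d = ≤/ℕ⇒*≤ (x∈p⇒1≤∣p∣ x∈S)
    (minimal S (x , x∈S) (ℚ.≤-trans (ℕtoℚ-mono-≤ ∣S∣≤s*2d) s*2d≤εn))
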